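{- The set $\{(1^n,v)\in\mathbb{YF}^2:\ n\geqslant 0,\ \#v=n\}$ is first-order definable in $\mathbf{YF}^*=\langle\mathbb{YF},\geqslant,2\rangle$.
   Context: $\mathbb{YF}$ is the set of all finite words (including the empty word $\varepsilon$) over $\{1,2\}$; $1^n$ denotes the word of $n$ ones. For a word $v$, $\#v$ is its length (number of letters) and $d(v)$ the number of letters $2$. Order: write $x=x'w$, $y=y'w$ with $w$ the longest common suffix; then $y\geqslant x$ iff $d(y')\geqslant\#x'$. $\mathbf{YF}^*$ is this partial order with an added constant symbol interpreted as the word $2$. A relation is first-order definable if there is a first-order formula in the language $\{\geqslant,2\}$ whose set of satisfying tuples is exactly the relation. -}

module Defs where

open import Data.Nat using (ℕ; zero; suc; _≥_)
open import Data.List using (List; []; _∷_; length; reverse; filter; replicate)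
open import Data.Product using (_×_; _,_; proj₁; proj₂; Σ)
open import Data.Sum using (_⊎_)
open import Data.Empty using (⊥)
open import Data.Unit using (⊤)
open import Relation.Binary.PropositionalEquality using (_≡_)

-- Words over {1,2}.  A word is a list of letters, written left to right
-- (head of the list = first letter of the word).

data Letter : Set where
  one two : Letter

Word : Set
Word = List Letter

ones : ℕ → Word
ones n = replicate n one

len : Word → ℕ
len = length

d : Word → ℕ
d [] = 0
d (one ∷ v) = d v
d (two ∷ v) = suc (d v)

stripPrefix : Word → Word → Word × Word
stripPrefix (one ∷ a) (one ∷ b) = stripPrefix a b
stripPrefix (two ∷ a) (two ∷ b) = stripPrefix a b
stripPrefix a b = a , b

stripSuffix : Word → Word → Word × Word
stripSuffix x y with stripPrefix (reverse x) (reverse y)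
... | (rx , ry) = reverse rx , reverse ry

_≽_ : Word → Word → Set
y ≽ x = d (proj₂ (stripSuffix x y)) ≥ len (proj₁ (stripSuffix x y))

-- First-order logic (with equality) in the language {≥, 2}.
-- Variables are de Bruijn indices (ℕ); a quantifier binds index 0.

data Term : Set where
  var : ℕ → Term
  c2  : Term

data Formula : Set where
  _≥'_ : Term → Term → Formula
  _≐_  : Term → Term → Formula
  ⊤'   : Formula
  ⊥'   : Formula
  ¬'_  : Formula → Formula
  _∧'_ : Formula → Formula → Formula
  _∨'_ : Formula → Formula → Formula
  _⇒'_ : Formula → Formula → Formula
  ∀'   : Formula → Formula
  ∃'   : Formula → Formula

Env : Set
Env = ℕ → Word

extend : Word → Env → Env
extend a ρ zero = a
extend a ρ (suc i) = ρ i

⟦_⟧ₜ : Term → Env → Word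
⟦ var i ⟧ₜ ρ = ρ i
⟦ c2 ⟧ₜ ρ = two ∷ []

Sat : Env → Formula → Set
Sat ρ (s ≥' t) = ⟦ s ⟧ₜ ρ ≽ ⟦ t ⟧ₜ ρ
Sat ρ (s ≐ t) = ⟦ s ⟧ₜ ρ ≡ ⟦ t ⟧ₜ ρ
Sat ρ ⊤' = ⊤
Sat ρ ⊥' = ⊥
Sat ρ (¬' φ) = Sat ρ φ → ⊥
Sat ρ (φ ∧' ψ) = Sat ρ φ × Sat ρ ψ
Sat ρ (φ ∨' ψ) = Sat ρ φ ⊎ Sat ρ ψ
Sat ρ (φ ⇒' ψ) = Sat ρ φ → Sat ρ ψ
Sat ρ (∀' φ) = (a : Word) → Sat (extend a ρ) φ
Sat ρ (∃' φ) = Σ Word (λ a → Sat (extend a ρ) φ)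

FODefinable₂ : (Word → Word → Set) → Set
FODefinable₂ R = Σ Formula (λ φ → (ρ : Env) →
  (Sat ρ φ → R (ρ 0) (ρ 1)) × (R (ρ 0) (ρ 1) → Sat ρ φ))

OnesLen : Word → Word → Set
OnesLen u v = Σ ℕ (λ n → (u ≡ ones n) × (len v ≡ n))

-- Reversal of words is an isomorphism from ⟨YF, ≥, 2⟩ onto the same set ordered by
-- comparing words after their longest common PREFIX, so one may work in the latter.
-- There the unary words ones n are exactly the words not above 2, and on them the
-- order compares lengths.  The "thin" words (ε, 1, 2·1^i) and the "probes" (above 2,
-- not below 2, 1·2·1^k among them) are definable, and quantifying over probes attaches
-- to ones (k+1) its "gauges": thin words 2·1^i with i ≥ k, 2·1^k being one of them.
-- Every common upper bound of ones n and one of its gauges contains at least n letters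
-- 2, and twos n is such a bound; hence "v lies below every such bound" says #v ≤ n,
-- and the least unary word with this property is ones (#v).
module Submission where

open import Defs
open import Data.Nat using (ℕ; zero; suc; _+_; _∸_; _≤_; z≤n; s≤s; s≤s⁻¹; _≤?_)
open import Data.Nat.Properties
  using (≤-refl; ≤-trans; ≤-antisym; ≤-reflexive; m≤n⇒m≤1+n; n≤1+n; ≰⇒>; m∸n+n≡m; +-comm; 1+n≰n; n<1⇒n≡0)
open import Data.List using ([]; _∷_; _++_; length; reverse; replicate; _∷ʳ_)
open import Data.List.Properties using (reverse-involutive; length-reverse; unfold-reverse; length-replicate)
open import Data.Product using (_×_; _,_; proj₁; proj₂; Σ; ∃-syntax; map₂)
open import Data.Product.Function.NonDependent.Propositional using (_×-⇔_)
open import Data.Sum using (_⊎_)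
open import Data.Sum.Function.Propositional using (_⊎-⇔_)
open import Data.Empty using (⊥; ⊥-elim)
open import Data.Unit using (⊤)
open import Function using (_∘_; _⇔_; mk⇔; Equivalence)
open import Function.Construct.Identity using (⇔-id)
open import Function.Related.TypeIsomorphisms using (→-cong-⇔; ¬-cong-⇔)
open import Relation.Nullary using (¬_; yes; no)
open import Relation.Binary.PropositionalEquality
open Equivalence using (to; from)

twos : ℕ → Word
twos n = replicate n two

[2] : Word
[2] = two ∷ []

d-++ : ∀ a b → d (a ++ b) ≡ d a + d b
d-++ [] b = refl
d-++ (one ∷ a) b = d-++ a b
d-++ (two ∷ a) b = cong suc (d-++ a b)

d-reverse : ∀ a → d (reverse a) ≡ d a
d-reverse [] = refl
d-reverse (x ∷ a) = begin
  d (reverse (x ∷ a))           ≡⟨ cong d (unfold-reverse x a) ⟩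
  d (reverse a ++ x ∷ [])       ≡⟨ d-++ (reverse a) (x ∷ []) ⟩
  d (reverse a) + d (x ∷ [])    ≡⟨ +-comm (d (reverse a)) (d (x ∷ [])) ⟩
  d (x ∷ []) + d (reverse a)    ≡⟨ cong (d (x ∷ []) +_) (d-reverse a) ⟩
  d (x ∷ []) + d a              ≡⟨ sym (d-++ (x ∷ []) a) ⟩
  d (x ∷ a)                     ∎
  where open ≡-Reasoning

d≤length : ∀ s → d s ≤ length s
d≤length [] = z≤n
d≤length (one ∷ s) = m≤n⇒m≤1+n (d≤length s)
d≤length (two ∷ s) = s≤s (d≤length s)

d-ones : ∀ n → d (ones n) ≡ 0
d-ones zero = refl
d-ones (suc n) = d-ones n

d-twos : ∀ n → d (twos n) ≡ n
d-twos zero = refl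
d-twos (suc n) = cong suc (d-twos n)

d-ones++twos : ∀ e m → d (ones e ++ twos m) ≡ m
d-ones++twos e m = trans (d-++ (ones e) (twos m)) (cong₂ _+_ (d-ones e) (d-twos m))

d≡0⇒≡ones : ∀ s → d s ≡ 0 → s ≡ ones (length s)
d≡0⇒≡ones [] _ = refl
d≡0⇒≡ones (one ∷ s) h = cong (one ∷_) (d≡0⇒≡ones s h)

length-ones : ∀ n → length (ones n) ≡ n
length-ones n = length-replicate n

replicate-∷ʳ : ∀ {A : Set} n (x : A) → replicate n x ∷ʳ x ≡ x ∷ replicate n x
replicate-∷ʳ zero x = refl
replicate-∷ʳ (suc n) x = cong (x ∷_) (replicate-∷ʳ n x)

reverse-replicate : ∀ {A : Set} n (x : A) → reverse (replicate n x) ≡ replicate n x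
reverse-replicate zero x = refl
reverse-replicate (suc n) x = begin
  reverse (x ∷ replicate n x)   ≡⟨ unfold-reverse x (replicate n x) ⟩
  reverse (replicate n x) ∷ʳ x  ≡⟨ cong (_∷ʳ x) (reverse-replicate n x) ⟩
  replicate n x ∷ʳ x            ≡⟨ replicate-∷ʳ n x ⟩
  x ∷ replicate n x             ∎
  where open ≡-Reasoning

_⊒_ : Word → Word → Set
s ⊒ r = length (proj₁ (stripPrefix r s)) ≤ d (proj₂ (stripPrefix r s))

≽⇔reverse-⊒ : ∀ y x → y ≽ x ⇔ reverse y ⊒ reverse x
≽⇔reverse-⊒ y x = mk⇔ (subst₂ _≤_ (length-reverse r) (d-reverse s))
                      (subst₂ _≤_ (sym (length-reverse r)) (sym (d-reverse s)))
  where
  r s : Word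
  r = proj₁ (stripPrefix (reverse x) (reverse y))
  s = proj₂ (stripPrefix (reverse x) (reverse y))

⊒⇒length≤ : ∀ r s → s ⊒ r → length r ≤ length s
⊒⇒length≤ [] s h = z≤n
⊒⇒length≤ (one ∷ r) [] h = h
⊒⇒length≤ (one ∷ r) (one ∷ s) h = s≤s (⊒⇒length≤ r s h)
⊒⇒length≤ (one ∷ r) (two ∷ s) h = ≤-trans h (d≤length (two ∷ s))
⊒⇒length≤ (two ∷ r) [] h = h
⊒⇒length≤ (two ∷ r) (one ∷ s) h = ≤-trans h (d≤length (one ∷ s))
⊒⇒length≤ (two ∷ r) (two ∷ s) h = s≤s (⊒⇒length≤ r s h)

⊒⇒d≤ : ∀ r s → s ⊒ r → d r ≤ d s
⊒⇒d≤ [] s h = z≤n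
⊒⇒d≤ (one ∷ r) [] ()
⊒⇒d≤ (one ∷ r) (one ∷ s) h = ⊒⇒d≤ r s h
⊒⇒d≤ (one ∷ r) (two ∷ s) h = ≤-trans (d≤length (one ∷ r)) h
⊒⇒d≤ (two ∷ r) [] ()
⊒⇒d≤ (two ∷ r) (one ∷ s) h = ≤-trans (d≤length (two ∷ r)) h
⊒⇒d≤ (two ∷ r) (two ∷ s) h = s≤s (⊒⇒d≤ r s h)

length≤d⇒⊒ : ∀ r s → length r ≤ d s → s ⊒ r
length≤d⇒⊒ [] s h = z≤n
length≤d⇒⊒ (one ∷ r) [] h = h
length≤d⇒⊒ (one ∷ r) (one ∷ s) h = length≤d⇒⊒ r s (≤-trans (n≤1+n _) h)
length≤d⇒⊒ (one ∷ r) (two ∷ s) h = h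
length≤d⇒⊒ (two ∷ r) [] h = h
length≤d⇒⊒ (two ∷ r) (one ∷ s) h = h
length≤d⇒⊒ (two ∷ r) (two ∷ s) h = length≤d⇒⊒ r s (s≤s⁻¹ h)

++-⊒ : ∀ r p → (r ++ p) ⊒ r
++-⊒ [] p = z≤n
++-⊒ (one ∷ r) p = ++-⊒ r p
++-⊒ (two ∷ r) p = ++-⊒ r p

ones-⊒-ones : ∀ {m n} → n ≤ m → ones m ⊒ ones n
ones-⊒-ones {m} {zero} _ = z≤n
ones-⊒-ones {suc m} {suc n} (s≤s n≤m) = ones-⊒-ones n≤m

ones-⊒-ones⁻¹ : ∀ m n → ones m ⊒ ones n → n ≤ m
ones-⊒-ones⁻¹ m n h = subst₂ _≤_ (length-ones n) (length-ones m) (⊒⇒length≤ (ones n) (ones m) h)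

ones-⋣ : ∀ m w → 1 ≤ d w → ¬ ones m ⊒ w
ones-⋣ m w 1≤dw h with subst (1 ≤_) (d-ones m) (≤-trans 1≤dw (⊒⇒d≤ w (ones m) h))
... | ()

twos-⊒-ones : ∀ n → twos n ⊒ ones n
twos-⊒-ones n = length≤d⇒⊒ (ones n) (twos n) (≤-reflexive (trans (length-ones n) (sym (d-twos n))))

ones++twos-⊒-ones : ∀ e m → (ones e ++ twos m) ⊒ ones (e + m)
ones++twos-⊒-ones zero m = twos-⊒-ones m
ones++twos-⊒-ones (suc e) m = ones++twos-⊒-ones e m

-- The definable sets.  Each predicate below is definitionally SatBy _⊒_ of the formula
-- defined next to it, whose ℕ arguments are the de Bruijn indices of its free variables.

Unary : Word → Set
Unary a = ¬ a ⊒ [2]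

unaryᶠ : ℕ → Formula
unaryᶠ i = ¬' (var i ≥' c2)

Thin : Word → Set
Thin x = (w : Word) → Unary w × x ⊒ w → [2] ⊒ w

thinᶠ : ℕ → Formula
thinᶠ i = ∀' ((unaryᶠ 0 ∧' (var (suc i) ≥' var 0)) ⇒' (c2 ≥' var 0))

Probe : Word → Set
Probe y = y ⊒ [2] × (¬ [2] ⊒ y × ((x : Word) → Thin x × y ⊒ x → [2] ⊒ x))

probeᶠ : ℕ → Formula
probeᶠ i = (var i ≥' c2) ∧' ((¬' (c2 ≥' var i)) ∧' ∀' ((thinᶠ 0 ∧' (var (suc i) ≥' var 0)) ⇒' (c2 ≥' var 0)))

BelowJoin : Word → Word → Word → Set
BelowJoin p x y = (z : Word) → z ⊒ p × z ⊒ x → z ⊒ y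

belowJoinᶠ : ℕ → ℕ → ℕ → Formula
belowJoinᶠ p x y = ∀' (((var 0 ≥' var (suc p)) ∧' (var 0 ≥' var (suc x))) ⇒' (var 0 ≥' var (suc y)))

Transfers : Word → Word → Set
Transfers p x = (y x' : Word) → (Probe y × Thin x') × BelowJoin p x' y → BelowJoin p x y

transfersᶠ : ℕ → ℕ → Formula
transfersᶠ p x = ∀' (∀' (((probeᶠ 1 ∧' thinᶠ 0) ∧' belowJoinᶠ (2 + p) 0 1) ⇒' belowJoinᶠ (2 + p) (2 + x) 1))

Gauge : Word → Word → Set
Gauge u x = Thin x × Σ Word (λ u' → (Unary u' × ¬ u ⊒ u') × Transfers u' x)

gaugeᶠ : ℕ → ℕ → Formula
gaugeᶠ u x = thinᶠ x ∧' ∃' ((unaryᶠ 0 ∧' (¬' (var (suc u) ≥' var 0))) ∧' transfersᶠ 0 (suc x))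

LengthAtMost : Word → Word → Set
LengthAtMost u v = (x z : Word) → (Gauge u x × z ⊒ u) × z ⊒ x → z ⊒ v

lengthAtMostᶠ : ℕ → ℕ → Formula
lengthAtMostᶠ u v =
  ∀' (∀' (((gaugeᶠ (2 + u) 1 ∧' (var 0 ≥' var (2 + u))) ∧' (var 0 ≥' var 1)) ⇒' (var 0 ≥' var (2 + v))))

IsLengthOf : Word → Word → Set
IsLengthOf u v = Unary u × (LengthAtMost u v × ((u' : Word) → Unary u' × LengthAtMost u' v → u' ⊒ u))

isLengthOfᶠ : Formula
isLengthOfᶠ = unaryᶠ 0 ∧' (lengthAtMostᶠ 0 1 ∧' ∀' ((unaryᶠ 0 ∧' lengthAtMostᶠ 0 2) ⇒' (var 0 ≥' var 1)))

unary⇒≡ones : ∀ a → Unary a → a ≡ ones (length a)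
unary⇒≡ones a u = d≡0⇒≡ones a (n<1⇒n≡0 (≰⇒> (u ∘ length≤d⇒⊒ [2] a)))

ones-unary : ∀ n → Unary (ones n)
ones-unary n = ones-⋣ n [2] (s≤s z≤n)

data ThinShape : Word → Set where
  nil      : ThinShape []
  single   : ThinShape (one ∷ [])
  two∷ones : ∀ i → ThinShape (two ∷ ones i)

thin-⋣-ones2 : ∀ {x} → Thin x → ¬ x ⊒ ones 2
thin-⋣-ones2 thin h with ⊒⇒length≤ (ones 2) [2] (thin (ones 2) (ones-unary 2 , h))
... | s≤s ()

thin-shape : ∀ x → Thin x → ThinShape x
thin-shape [] _ = nil
thin-shape (one ∷ []) _ = single
thin-shape (one ∷ one ∷ r) thin = ⊥-elim (thin-⋣-ones2 thin z≤n)
thin-shape (one ∷ two ∷ r) thin = ⊥-elim (thin-⋣-ones2 thin (s≤s z≤n))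
thin-shape (two ∷ r) thin with d r in dr
... | zero = subst ThinShape (cong (two ∷_) (sym (d≡0⇒≡ones r dr))) (two∷ones (length r))
... | suc k = ⊥-elim (thin-⋣-ones2 thin (subst (λ t → 2 ≤ suc t) (sym dr) (s≤s (s≤s z≤n))))

thin-intro : ∀ x → (∀ w → Unary w → x ⊒ w → length w ≤ 1) → Thin x
thin-intro x short w (unary , x⊒w) = length≤d⇒⊒ w [2] (short w unary x⊒w)

thin-two∷ones : ∀ i → Thin (two ∷ ones i)
thin-two∷ones i = thin-intro (two ∷ ones i) short
  where
  short : ∀ w → Unary w → (two ∷ ones i) ⊒ w → length w ≤ 1
  short [] _ _ = z≤n
  short (one ∷ w) _ h = subst (λ t → suc (length w) ≤ suc t) (d-ones i) h
  short (two ∷ w) unary _ = ⊥-elim (unary z≤n)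

thinOfLength : ℕ → Word
thinOfLength zero = []
thinOfLength (suc k) = two ∷ ones k

thin-thinOfLength : ∀ n → Thin (thinOfLength n)
thin-thinOfLength zero = thin-intro [] (λ w _ h → ≤-trans (⊒⇒length≤ w [] h) z≤n)
thin-thinOfLength (suc k) = thin-two∷ones k

twos-⊒-thinOfLength : ∀ n → twos n ⊒ thinOfLength n
twos-⊒-thinOfLength zero = z≤n
twos-⊒-thinOfLength (suc k) =
  length≤d⇒⊒ (two ∷ ones k) (twos (suc k)) (≤-reflexive (cong suc (trans (length-ones k) (sym (d-twos k)))))

probe⇒≡one∷ : ∀ y → Probe y → ∃[ y' ] y ≡ one ∷ y'
probe⇒≡one∷ [] (() , _)
probe⇒≡one∷ (one ∷ y') _ = y' , refl
probe⇒≡one∷ (two ∷ []) (_ , y⋢2 , _) = ⊥-elim (y⋢2 z≤n)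
probe⇒≡one∷ (two ∷ a ∷ y) (_ , _ , thin-below) with thin-below (two ∷ one ∷ []) (thin-two∷ones 1 , above a)
  where
  above : ∀ a → (two ∷ a ∷ y) ⊒ (two ∷ one ∷ [])
  above one = z≤n
  above two = s≤s z≤n
... | ()

probe-one∷two∷ones : ∀ k → Probe (one ∷ two ∷ ones k)
probe-one∷two∷ones k = s≤s z≤n , not-below , thin-below
  where
  not-below : ¬ [2] ⊒ (one ∷ two ∷ ones k)
  not-below h with ⊒⇒length≤ (one ∷ two ∷ ones k) [2] h
  ... | s≤s ()
  thin-below : (x : Word) → Thin x × (one ∷ two ∷ ones k) ⊒ x → [2] ⊒ x
  thin-below x (thin , h) with thin-shape x thin
  ... | nil = z≤n
  ... | single = s≤s z≤n
  ... | two∷ones zero = z≤n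
  ... | two∷ones (suc i) with subst (λ t → 2 + length (ones i) ≤ suc t) (d-ones k) h
  ...   | s≤s ()

one∷-belowJoin : ∀ n y → length y ≤ n → BelowJoin (ones (suc n)) (thinOfLength n) (one ∷ y)
one∷-belowJoin zero [] _ z (z⊒1 , _) = z⊒1
one∷-belowJoin (suc k) y |y|≤ [] (() , _)
one∷-belowJoin (suc k) y |y|≤ (two ∷ q) (z⊒ones , _) =
  ≤-trans (s≤s |y|≤) (subst (λ t → 2 + t ≤ suc (d q)) (length-ones k) z⊒ones)
one∷-belowJoin (suc k) y |y|≤ (one ∷ q) (_ , z⊒thin) =
  length≤d⇒⊒ y q (≤-trans |y|≤ (subst (λ t → suc t ≤ d q) (length-ones k) z⊒thin))

two∷-bound⇒length≤ : ∀ m x y q → d q ≡ m → (two ∷ q) ⊒ x →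
                     BelowJoin (ones (suc m)) x (one ∷ y) → length y ≤ m
two∷-bound⇒length≤ m x y q dq z⊒x below =
  s≤s⁻¹ (subst (λ t → suc (length y) ≤ suc t) dq (below (two ∷ q) (z⊒ones , z⊒x)))
  where
  z⊒ones : (two ∷ q) ⊒ ones (suc m)
  z⊒ones = length≤d⇒⊒ (ones (suc m)) (two ∷ q) (≤-reflexive (cong suc (trans (length-ones m) (sym dq))))

belowJoin⇒length≤ : ∀ m x y → Thin x → BelowJoin (ones (suc m)) x (one ∷ y) → length y ≤ m
belowJoin⇒length≤ m x y thin with thin-shape x thin
... | nil = two∷-bound⇒length≤ m x y (twos m) (d-twos m) z≤n
... | single = two∷-bound⇒length≤ m x y (twos m) (d-twos m) (s≤s z≤n)
... | two∷ones i = two∷-bound⇒length≤ m x y (ones i ++ twos m) (d-ones++twos i m) (++-⊒ (ones i) (twos m))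

ones-⋢-belowJoin-probe : ∀ j x → ones (2 + j) ⊒ x → ¬ BelowJoin (ones (2 + j)) x (one ∷ two ∷ ones j)
ones-⋢-belowJoin-probe j x ones⊒x below =
  ones-⋣ (2 + j) (one ∷ two ∷ ones j) (s≤s z≤n) (below (ones (2 + j)) (ones-⊒-ones {2 + j} ≤-refl , ones⊒x))

belowJoin-probe⇒ : ∀ j x → Thin x → BelowJoin (ones (2 + j)) x (one ∷ two ∷ ones j) →
                   ∃[ i ] x ≡ two ∷ ones i × j ≤ i
belowJoin-probe⇒ j x thin below with thin-shape x thin
... | nil = ⊥-elim (ones-⋢-belowJoin-probe j [] z≤n below)
... | single = ⊥-elim (ones-⋢-belowJoin-probe j (one ∷ []) z≤n below)
... | two∷ones i with j ≤? i
...   | yes j≤i = i , refl , j≤i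
...   | no j≰i =
  ⊥-elim (j≰i (s≤s⁻¹ (subst₂ _≤_ (cong suc (length-ones j)) (d-ones++twos e (suc i)) z⊒probe)))
  where
  -- z bounds ones (2 + j) and x but has only i + 1 < j + 1 letters 2.
  e : ℕ
  e = j ∸ suc i
  z : Word
  z = ones (2 + e) ++ twos (suc i)
  z⊒ones : z ⊒ ones (2 + j)
  z⊒ones = subst (λ t → z ⊒ ones (2 + t)) (m∸n+n≡m (≰⇒> j≰i)) (ones++twos-⊒-ones (2 + e) (suc i))
  z⊒x : z ⊒ (two ∷ ones i)
  z⊒x = length≤d⇒⊒ (two ∷ ones i) z
          (≤-reflexive (trans (cong suc (length-ones i)) (sym (d-ones++twos e (suc i)))))
  z⊒probe : z ⊒ (one ∷ two ∷ ones j)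
  z⊒probe = below z (z⊒ones , z⊒x)

transfers-ones⇒ : ∀ j x → Thin x → Transfers (ones (2 + j)) x → ∃[ i ] x ≡ two ∷ ones i × j ≤ i
transfers-ones⇒ j x thin transfers =
  belowJoin-probe⇒ j x thin
    (transfers (one ∷ two ∷ ones j) (two ∷ ones j)
      ((probe-one∷two∷ones j , thin-two∷ones j) ,
       one∷-belowJoin (suc j) (two ∷ ones j) (s≤s (≤-reflexive (length-ones j)))))

gauge-ones⇒ : ∀ k x → Gauge (ones (suc k)) x → ∃[ i ] x ≡ two ∷ ones i × k ≤ i
gauge-ones⇒ k x (thin , u , (unary , ones⋣u) , transfers) =
  unary-case (length u) (subst (λ t → ¬ ones (suc k) ⊒ t) u≡ ones⋣u)
                        (subst (λ t → Transfers t x) u≡ transfers)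
  where
  u≡ : u ≡ ones (length u)
  u≡ = unary⇒≡ones u unary
  unary-case : ∀ m → ¬ ones (suc k) ⊒ ones m → Transfers (ones m) x → ∃[ i ] x ≡ two ∷ ones i × k ≤ i
  unary-case m ones⋣ tr with ≰⇒> (ones⋣ ∘ ones-⊒-ones {suc k} {m})
  unary-case (suc (suc j)) ones⋣ tr | s≤s (s≤s k≤j) =
    map₂ (map₂ (≤-trans k≤j)) (transfers-ones⇒ j x thin tr)

gauge-thinOfLength : ∀ n → Gauge (ones n) (thinOfLength n)
gauge-thinOfLength n =
  thin-thinOfLength n , ones (suc n) , (ones-unary (suc n) , ones⋣ones-suc) , transfers
  where
  ones⋣ones-suc : ¬ ones n ⊒ ones (suc n)
  ones⋣ones-suc = 1+n≰n ∘ ones-⊒-ones⁻¹ n (suc n)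
  transfers : Transfers (ones (suc n)) (thinOfLength n)
  transfers y x ((probe , thin) , below) with probe⇒≡one∷ y probe
  ... | y' , refl = one∷-belowJoin n y' (belowJoin⇒length≤ n x y' thin below)

⊒ones,two∷ones⇒d≥ : ∀ k i z → k ≤ i → z ⊒ ones (suc k) → z ⊒ (two ∷ ones i) → suc k ≤ d z
⊒ones,two∷ones⇒d≥ k i [] k≤i () _
⊒ones,two∷ones⇒d≥ k i (two ∷ q) k≤i z⊒ones _ = subst (λ t → suc t ≤ suc (d q)) (length-ones k) z⊒ones
⊒ones,two∷ones⇒d≥ k i (one ∷ q) k≤i _ z⊒x =
  ≤-trans (s≤s k≤i) (subst (λ t → suc t ≤ d q) (length-ones i) z⊒x)

lengthAtMost-ones⇒ : ∀ n v → LengthAtMost (ones n) v → length v ≤ n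
lengthAtMost-ones⇒ n v lengthAtMost =
  subst (length v ≤_) (length-replicate n)
    (⊒⇒length≤ v (twos n)
      (lengthAtMost (thinOfLength n) (twos n)
        ((gauge-thinOfLength n , twos-⊒-ones n) , twos-⊒-thinOfLength n)))

lengthAtMost-ones⇐ : ∀ n v → length v ≤ n → LengthAtMost (ones n) v
lengthAtMost-ones⇐ zero v |v|≤ x z _ = length≤d⇒⊒ v z (≤-trans |v|≤ z≤n)
lengthAtMost-ones⇐ (suc k) v |v|≤ x z ((gauge , z⊒ones) , z⊒x) with gauge-ones⇒ k x gauge
... | i , refl , k≤i = length≤d⇒⊒ v z (≤-trans |v|≤ (⊒ones,two∷ones⇒d≥ k i z k≤i z⊒ones z⊒x))

isLengthOf-ones⇒ : ∀ n v → IsLengthOf (ones n) v → n ≡ length v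
isLengthOf-ones⇒ n v (_ , lengthAtMost , least) =
  ≤-antisym (ones-⊒-ones⁻¹ (length v) n 
              (least (ones (length v)) (ones-unary (length v) , lengthAtMost-ones⇐ (length v) v ≤-refl)))
            (lengthAtMost-ones⇒ n v lengthAtMost)

isLengthOf⇒ : ∀ u v → IsLengthOf u v → u ≡ ones (length v)
isLengthOf⇒ u v isLengthOf@(unary , _) =
  trans u≡ (cong ones (isLengthOf-ones⇒ (length u) v (subst (λ t → IsLengthOf t v) u≡ isLengthOf)))
  where
  u≡ : u ≡ ones (length u)
  u≡ = unary⇒≡ones u unary

isLengthOf-ones-length : ∀ v → IsLengthOf (ones (length v)) v
isLengthOf-ones-length v = ones-unary (length v) , lengthAtMost-ones⇐ (length v) v ≤-refl , least
  where
  least : (u : Word) → Unary u × LengthAtMost u v → u ⊒ ones (length v)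
  least u (unary , lengthAtMost) =
    subst (_⊒ ones (length v)) (sym u≡)
      (ones-⊒-ones (lengthAtMost-ones⇒ (length u) v (subst (λ t → LengthAtMost t v) u≡ lengthAtMost)))
    where
    u≡ : u ≡ ones (length u)
    u≡ = unary⇒≡ones u unary

SatBy : (Word → Word → Set) → Env → Formula → Set
SatBy R ρ (s ≥' t) = R (⟦ s ⟧ₜ ρ) (⟦ t ⟧ₜ ρ)
SatBy R ρ (s ≐ t) = ⟦ s ⟧ₜ ρ ≡ ⟦ t ⟧ₜ ρ
SatBy R ρ ⊤' = ⊤
SatBy R ρ ⊥' = ⊥
SatBy R ρ (¬' ψ) = SatBy R ρ ψ → ⊥
SatBy R ρ (ψ ∧' χ) = SatBy R ρ ψ × SatBy R ρ χ
SatBy R ρ (ψ ∨' χ) = SatBy R ρ ψ ⊎ SatBy R ρ χ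
SatBy R ρ (ψ ⇒' χ) = SatBy R ρ ψ → SatBy R ρ χ
SatBy R ρ (∀' ψ) = (a : Word) → SatBy R (extend a ρ) ψ
SatBy R ρ (∃' ψ) = Σ Word (λ a → SatBy R (extend a ρ) ψ)

module Isomorphism
  (R : Word → Word → Set) (f : Word → Word)
  (f-involutive : ∀ a → f (f a) ≡ a) (f-[2] : f [2] ≡ [2])
  (f-order : ∀ s t → s ≽ t ⇔ R (f s) (f t))
  where

  ⟦⟧ₜ-f : ∀ t {ρ σ} → σ ≗ f ∘ ρ → ⟦ t ⟧ₜ σ ≡ f (⟦ t ⟧ₜ ρ)
  ⟦⟧ₜ-f (var i) σ≗ = σ≗ i
  ⟦⟧ₜ-f c2 _ = sym f-[2]

  extend-f : ∀ a {ρ σ} → σ ≗ f ∘ ρ → extend (f a) σ ≗ f ∘ extend a ρ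
  extend-f a σ≗ zero = refl
  extend-f a σ≗ (suc i) = σ≗ i

  extend-f⁻ : ∀ b {ρ σ} → σ ≗ f ∘ ρ → extend b σ ≗ f ∘ extend (f b) ρ
  extend-f⁻ b σ≗ zero = sym (f-involutive b)
  extend-f⁻ b σ≗ (suc i) = σ≗ i

  sat⇔satBy : ∀ ψ {ρ σ} → σ ≗ f ∘ ρ → Sat ρ ψ ⇔ SatBy R σ ψ
  sat⇔satBy (s ≥' t) σ≗ = mk⇔
    (subst₂ R (sym (⟦⟧ₜ-f s σ≗)) (sym (⟦⟧ₜ-f t σ≗)) ∘ to (f-order _ _))
    (from (f-order _ _) ∘ subst₂ R (⟦⟧ₜ-f s σ≗) (⟦⟧ₜ-f t σ≗))
  sat⇔satBy (s ≐ t) σ≗ = mk⇔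
    (λ eq → trans (⟦⟧ₜ-f s σ≗) (trans (cong f eq) (sym (⟦⟧ₜ-f t σ≗))))
    (λ eq → f-injective (trans (sym (⟦⟧ₜ-f s σ≗)) (trans eq (⟦⟧ₜ-f t σ≗))))
    where
    f-injective : ∀ {a b} → f a ≡ f b → a ≡ b
    f-injective {a} {b} eq = trans (sym (f-involutive a)) (trans (cong f eq) (f-involutive b))
  sat⇔satBy ⊤' _ = ⇔-id _
  sat⇔satBy ⊥' _ = ⇔-id _
  sat⇔satBy (¬' ψ) σ≗ = ¬-cong-⇔ (sat⇔satBy ψ σ≗)
  sat⇔satBy (ψ ∧' χ) σ≗ = sat⇔satBy ψ σ≗ ×-⇔ sat⇔satBy χ σ≗
  sat⇔satBy (ψ ∨' χ) σ≗ = sat⇔satBy ψ σ≗ ⊎-⇔ sat⇔satBy χ σ≗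
  sat⇔satBy (ψ ⇒' χ) σ≗ = →-cong-⇔ (sat⇔satBy ψ σ≗) (sat⇔satBy χ σ≗)
  sat⇔satBy (∀' ψ) σ≗ = mk⇔
    (λ h b → to (sat⇔satBy ψ (extend-f⁻ b σ≗)) (h (f b)))
    (λ h a → from (sat⇔satBy ψ (extend-f a σ≗)) (h (f a)))
  sat⇔satBy (∃' ψ) σ≗ = mk⇔
    (λ (a , h) → f a , to (sat⇔satBy ψ (extend-f a σ≗)) h)
    (λ (b , h) → f b , from (sat⇔satBy ψ (extend-f⁻ b σ≗)) h)

open Isomorphism _⊒_ reverse reverse-involutive refl ≽⇔reverse-⊒

isLengthOf-reverse⇔onesLen : ∀ u v → IsLengthOf (reverse u) (reverse v) ⇔ OnesLen u v
isLengthOf-reverse⇔onesLen u v = mk⇔ to′ from′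
  where
  reverse-ones : ∀ n → reverse (ones n) ≡ ones n
  reverse-ones n = reverse-replicate n one
  to′ : IsLengthOf (reverse u) (reverse v) → OnesLen u v
  to′ h = length v , u≡ , refl
    where
    u≡ : u ≡ ones (length v)
    u≡ = begin
      u                                ≡⟨ sym (reverse-involutive u) ⟩
      reverse (reverse u)              ≡⟨ cong reverse (isLengthOf⇒ (reverse u) (reverse v) h) ⟩
      reverse (ones (length (reverse v))) ≡⟨ reverse-ones _ ⟩
      ones (length (reverse v))        ≡⟨ cong ones (length-reverse v) ⟩
      ones (length v)                  ∎
      where open ≡-Reasoning
  from′ : OnesLen u v → IsLengthOf (reverse u) (reverse v)
  from′ (n , refl , refl) =
    subst (λ t → IsLengthOf t (reverse v))
      (trans (cong ones (length-reverse v)) (sym (reverse-ones (length v))))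
      (isLengthOf-ones-length (reverse v))

mainTheorem14 : FODefinable₂ OnesLen
mainTheorem14 = isLengthOfᶠ , λ ρ →
  let sat⇔ = sat⇔satBy isLengthOfᶠ {ρ} {reverse ∘ ρ} (λ _ → refl)
      iff  = isLengthOf-reverse⇔onesLen (ρ 0) (ρ 1)
  in  to iff ∘ to sat⇔ , from sat⇔ ∘ from iff
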